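{- Let $d\ge2$, $\mathbb{F}$ a field, $0\neq q\in\mathbb{F}$, and $T\in{\rm Mat}_{d+1}(\mathbb{F})$ with $T_{ij}={j\brack i}_q$ for $0\le i\le j\le d$ and $T_{ij}=0$ for $i>j$ (this $T$ is very good upper triangular). Let $B$ be a Billiard Array in $b(T)$. Then the $B$-value of every $\tau\in\Delta_{d-2}$ equals $q^{ -1}$.
   Context: ${n\brack k}_q$ is the Gaussian binomial coefficient (a polynomial in $q$ with integer coefficients) evaluated at $q$. Matrices are indexed by $0,\dots,d$; $T[i,j]$ is the submatrix with rows $0,\dots,j-i$, columns $i,\dots,j$; very good means all $T[i,j]$ invertible. $\Delta_n=\{(r,s,t)\in\mathbb{N}^3:r+s+t=n\}$. A line is a set of elements of $\Delta_d$ with a fixed coordinate; a black 3-clique is $\{(a+1,b,c),(a,b+1,c),(a,b,c+1)\}$, $(a,b,c)\in\Delta_{d-1}$. A Billiard Array on a $(d+1)$-dimensional space $V$ is a map $\lambda\mapsto B_\lambda$ from $\Delta_d$ to 1-dimensional subspaces with direct sums along lines and non-direct sums over black 3-cliques. $b(T)$ is the isomorphism class (under linear bijections $\sigma$ with $\sigma(B_\lambda)=B'_\lambda$) of the Billiard Array $B_{(r,s,t)}=U_{d-r}\cap U'_{d-s}\cap U''_{d-t}$, where for a basis $\{u_i\}$ of $V$ and $v_j=\sum_iT_{ij}u_i$: $U_i=\mathbb{F}u_0+\cdots+\mathbb{F}u_i$, $U'_i=\mathbb{F}u_d+\cdots+\mathbb{F}u_{d-i}$, $U''_i=\mathbb{F}v_d+\cdots+\mathbb{F}v_{d-i}$.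 Adjacent locations $\lambda,\mu$ (difference in $\{\pm(1,-1,0),\pm(0,1,-1),\pm(-1,0,1)\}$) lie in a unique black 3-clique $\{\lambda,\mu,\nu\}$, and $\widetilde B_{\lambda,\mu}:B_\lambda\to B_\mu$ sends nonzero $u$ to the unique nonzero $v\in B_\mu$ with $u+v\in B_\nu$. For $\tau=(r,s,t)\in\Delta_{d-2}$ with $\lambda=(r,s+1,t+1)$, $\mu=(r+1,s,t+1)$, $\nu=(r+1,s+1,t)$, the $B$-value of $\tau$ is the scalar $c$ with $\widetilde B_{\nu,\lambda}\widetilde B_{\mu,\nu}\widetilde B_{\lambda,\mu}=c\,\mathrm{id}_{B_\lambda}$. -}

module Defs where

open import Level using (Level; _⊔_) renaming (suc to lsuc)
open import Data.Nat using (ℕ; zero; suc; _∸_; _<_; _≤?_) renaming (_+_ to _+ℕ_)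
open import Data.Fin using (Fin; toℕ)
import Data.Fin as Fin
open import Relation.Binary.PropositionalEquality using (_≡_)
open import Data.Product using (Σ; ∃; _×_; _,_)
open import Data.Bool using (if_then_else_)
open import Relation.Nullary using (¬_; does)
open import Algebra.Bundles using (CommutativeRing)
open import Algebra.Module.Bundles using (Module)

record Field (c ℓ : Level) : Set (lsuc (c ⊔ ℓ)) where
  field
    commutativeRing : CommutativeRing c ℓ
  open CommutativeRing commutativeRing public
  field
    0≉1     : ¬ (0# ≈ 1#)
    inverse : ∀ x → ¬ (x ≈ 0#) → ∃ λ y → x * y ≈ 1#

module _ {c ℓ : Level} (F : Field c ℓ) where
  open Field F

  pow : Carrier → ℕ → Carrier
  pow x zero    = 1#
  pow x (suc n) = x * pow x n

  -- Gaussian binomial coefficient [n choose k]_q, evaluated at q,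
  -- via the q-Pascal rule [n+1,k+1] = [n,k] + q^(k+1) [n,k+1].
  gauss : Carrier → ℕ → ℕ → Carrier
  gauss q n       zero    = 1#
  gauss q zero    (suc k) = 0#
  gauss q (suc n) (suc k) = gauss q n k + pow q (suc k) * gauss q n (suc k)

  sumF : (n : ℕ) → (Fin n → Carrier) → Carrier
  sumF zero    f = 0#
  sumF (suc n) f = f Fin.zero + sumF n (λ i → f (Fin.suc i))

  Tq : (d : ℕ) → Carrier → Fin (suc d) → Fin (suc d) → Carrier
  Tq d q i j = if does (toℕ i ≤? toℕ j) then gauss q (toℕ j) (toℕ i) else 0#

  -- The Billiard Array b(T) built on V₀ = F^{d+1} with u_i the standard
  -- basis vectors and v_j = Σ_i T i j u_i (the j-th column of T).

  Vec₀ : ℕ → Set c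
  Vec₀ d = Fin (suc d) → Carrier

  -- U_k = F u_0 + ... + F u_k
  InU : (d k : ℕ) → Vec₀ d → Set ℓ
  InU d k y = ∀ i → k < toℕ i → y i ≈ 0#

  -- U'_k = F u_d + ... + F u_{d-k}
  InU' : (d k : ℕ) → Vec₀ d → Set ℓ
  InU' d k y = ∀ i → toℕ i < d ∸ k → y i ≈ 0#

  -- U''_k = F v_d + ... + F v_{d-k}
  InU'' : (d : ℕ) → (Fin (suc d) → Fin (suc d) → Carrier) → (k : ℕ) → Vec₀ d → Set (c ⊔ ℓ)
  InU'' d T k y = ∃ λ (x : Vec₀ d) →
    (∀ j → toℕ j < d ∸ k → x j ≈ 0#) × (∀ i → y i ≈ sumF (suc d) (λ j → T i j * x j))

  -- B_(r,s,t) = U_{d-r} ∩ U'_{d-s} ∩ U''_{d-t}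
  BT : (d : ℕ) → (Fin (suc d) → Fin (suc d) → Carrier) → ℕ → ℕ → ℕ → Vec₀ d → Set (c ⊔ ℓ)
  BT d T r s t y = InU d (d ∸ r) y × InU' d (d ∸ s) y × InU'' d T (d ∸ t) y

  module _ {m ℓm : Level} (V : Module commutativeRing m ℓm) where
    open Module V

    record IsLinearBijection (d : ℕ) (σ : Carrierᴹ → Vec₀ d) : Set (c ⊔ ℓ ⊔ m ⊔ ℓm) where
      field
        σ-cong    : ∀ {x y} → x ≈ᴹ y → ∀ i → σ x i ≈ σ y i
        σ-+       : ∀ x y i → σ (x +ᴹ y) i ≈ σ x i + σ y i
        σ-*       : ∀ a x i → σ (a *ₗ x) i ≈ a * σ x i
        σ-inj     : ∀ {x y} → (∀ i → σ x i ≈ σ y i) → x ≈ᴹ y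
        σ-surj    : ∀ (z : Vec₀ d) → ∃ λ x → ∀ i → σ x i ≈ z i

    IsoToBT : {p : Level} (d : ℕ) (T : Fin (suc d) → Fin (suc d) → Carrier)
              (B : ℕ → ℕ → ℕ → Carrierᴹ → Set p) → Set (c ⊔ ℓ ⊔ m ⊔ ℓm ⊔ p)
    IsoToBT d T B = ∃ λ (σ : Carrierᴹ → Vec₀ d) → IsLinearBijection d σ ×
      (∀ r s t → r +ℕ s +ℕ t ≡ d → ∀ y → (B r s t y → BT d T r s t (σ y)) × (BT d T r s t (σ y) → B r s t y))

    -- Graph of the map B̃_{λ,μ} : B_λ → B_μ, where ν is the third element of
    -- the black 3-clique containing λ, μ: v is the image of u iff
    -- v is a nonzero element of B_μ with u + v ∈ B_ν.
    module _ {p : Level} (B : ℕ → ℕ → ℕ → Carrierᴹ → Set p) where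
      Loc : Set
      Loc = ℕ × ℕ × ℕ

      _∈B_ : Carrierᴹ → Loc → Set p
      y ∈B (r , s , t) = B r s t y

      Tilde : (μ ν : Loc) → Carrierᴹ → Carrierᴹ → Set (ℓm ⊔ p)
      Tilde μ ν u v = v ∈B μ × ¬ (v ≈ᴹ 0ᴹ) × (u +ᴹ v) ∈B ν

      -- "c is the B-value of τ = (r,s,t)": with λ = (r,s+1,t+1),
      -- μ = (r+1,s,t+1), ν = (r+1,s+1,t), the composite
      -- B̃_{ν,λ} B̃_{μ,ν} B̃_{λ,μ} is defined on every nonzero u ∈ B_λ and
      -- equals c · id.  (The third clique points are (r,s,t+2) for λ,μ;
      -- (r+2,s,t) for μ,ν; (r,s+2,t) for ν,λ.)
      IsBValue : (r s t : ℕ) → Carrier → Set (m ⊔ ℓm ⊔ p)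
      IsBValue r s t c₀ = ∀ u → u ∈B λ₀ → ¬ (u ≈ᴹ 0ᴹ) →
          (∃ λ v → ∃ λ w → ∃ λ x →
             Tilde μ₀ (r , s , suc (suc t)) u v ×
             Tilde ν₀ (suc (suc r) , s , t) v w ×
             Tilde λ₀ (r , suc (suc s) , t) w x)
        × (∀ v w x →
             Tilde μ₀ (r , s , suc (suc t)) u v →
             Tilde ν₀ (suc (suc r) , s , t) v w →
             Tilde λ₀ (r , suc (suc s) , t) w x →
             x ≈ᴹ c₀ *ₗ u)
        where
          λ₀ μ₀ ν₀ : Loc
          λ₀ = (r , suc s , suc t)
          μ₀ = (suc r , s , suc t)
          ν₀ = (suc r , suc s , t)

module Submission where

-- In F^{d+1} the point B_(r,s,t) of b(T) depends only on (s,t): it is the line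
-- spanned by  line s t = shiftˢ (column t),  where column t is the t-th column of
-- T and (shift y)_{i+1} = q^{-i} y_i.  To see this, compare two bases of the span
-- of the columns t, …, t+s.  The columns are in upper echelon form, so a vector
-- T x (x ∈ ⟨u_t, …, u_d⟩) vanishing in the rows > s+t lies in that span; the
-- vectors line 0 t, …, line s t are in lower echelon form, so such a vector that
-- also vanishes in the rows < s is a multiple of line s t.  The second q-Pascal
-- rule gives, for every black 3-clique,  line s (t+1) = line s t + q^t line (s+1) t,
-- where line s t and line (s+1) t are independent.  Plain linear algebra on such
-- a triangle A, B, C = A + κB (module Triangle) shows that each map B̃ multiplies
-- coefficients by κ⁻¹, -κ or -1.  Around τ = (r,s,t) these ratios are q^{-(t+1)},
-- -q^t and -1, whose product is q⁻¹.

open import Defs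
open import Level using (Level; _⊔_)
open import Data.Nat using (ℕ; zero; suc; _<_; _≤_; _∸_; _≤′_; ≤′-refl; ≤′-step; s≤s; z≤n; _<?_; _≤ᵇ_)
  renaming (_+_ to _+ℕ_)
import Data.Nat.Properties as ℕₚ
open import Data.Nat.Tactic.RingSolver using (solve-∀)
open import Data.Bool using (true; false; T)
open import Data.Fin using (Fin; toℕ; fromℕ<)
import Data.Fin as Fin
import Data.Fin.Properties as Finₚ
open import Data.Product using (∃; _×_; _,_; proj₁; proj₂)
open import Relation.Nullary using (¬_; yes; no)
import Relation.Binary.PropositionalEquality as ≡
open ≡ using (_≡_)
open import Algebra.Module.Bundles using (Module)

module LinearAlgebra {c ℓ : Level} (F : Field c ℓ) where
  open Field F hiding (zero)
  open import Relation.Binary.Reasoning.Setoid setoid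
  open import Algebra.Solver.Ring.NaturalCoefficients.Default commutativeSemiring
  open import Algebra.Properties.Semiring.Sum semiring using (sum; sum-syntax)
  open import Algebra.Properties.Ring ring using (+-inverseʳ-unique; -‿distribˡ-*; -1*x≈-x; -‿involutive; -0#≈0#)

  *-nonzero : ∀ {x y} → ¬ x ≈ 0# → ¬ y ≈ 0# → ¬ x * y ≈ 0#
  *-nonzero {x} {y} x≉0 y≉0 xy≈0 with inverse x x≉0
  ... | x⁻¹ , xx⁻¹≈1 = y≉0 (begin
      y              ≈⟨ sym (*-identityˡ y) ⟩
      1# * y         ≈⟨ *-cong (sym xx⁻¹≈1) refl ⟩
      (x * x⁻¹) * y  ≈⟨ solve 3 (λ x x⁻¹ y → (x :* x⁻¹) :* y := x⁻¹ :* (x :* y)) refl x x⁻¹ y ⟩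
      x⁻¹ * (x * y)  ≈⟨ *-cong refl xy≈0 ⟩
      x⁻¹ * 0#       ≈⟨ zeroʳ x⁻¹ ⟩
      0#             ∎)

  *-cancelʳ : ∀ {x y z} → ¬ z ≈ 0# → x * z ≈ y * z → x ≈ y
  *-cancelʳ {x} {y} {z} z≉0 xz≈yz with inverse z z≉0
  ... | z⁻¹ , zz⁻¹≈1 = begin
      x              ≈⟨ sym (*-identityʳ x) ⟩
      x * 1#         ≈⟨ *-cong refl (sym zz⁻¹≈1) ⟩
      x * (z * z⁻¹)  ≈⟨ sym (*-assoc x z z⁻¹) ⟩
      (x * z) * z⁻¹  ≈⟨ *-cong xz≈yz refl ⟩
      (y * z) * z⁻¹  ≈⟨ *-assoc y z z⁻¹ ⟩
      y * (z * z⁻¹)  ≈⟨ *-cong refl zz⁻¹≈1 ⟩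
      y * 1#         ≈⟨ *-identityʳ y ⟩
      y              ∎

  invertible-nonzero : ∀ {x y} → x * y ≈ 1# → ¬ x ≈ 0#
  invertible-nonzero {x} {y} xy≈1 x≈0 =
    0≉1 (trans (sym (zeroˡ y)) (trans (*-cong (sym x≈0) refl) xy≈1))

  -‿nonzero : ∀ {x} → ¬ x ≈ 0# → ¬ - x ≈ 0#
  -‿nonzero x≉0 -x≈0 = x≉0 (trans (sym (-‿involutive _)) (trans (-‿cong -x≈0) -0#≈0#))

  pow-nonzero : ∀ {x} n → ¬ x ≈ 0# → ¬ pow F x n ≈ 0#
  pow-nonzero zero    x≉0 1≈0 = 0≉1 (sym 1≈0)
  pow-nonzero (suc n) x≉0     = *-nonzero x≉0 (pow-nonzero n x≉0)

  pow-inverse : ∀ {x y} → x * y ≈ 1# → ∀ n → pow F x n * pow F y n ≈ 1#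
  pow-inverse xy≈1 zero    = *-identityˡ 1#
  pow-inverse {x} {y} xy≈1 (suc n) = begin
    (x * xⁿ) * (y * yⁿ)  ≈⟨ solve 4 (λ x xⁿ y yⁿ → (x :* xⁿ) :* (y :* yⁿ) := (x :* y) :* (xⁿ :* yⁿ)) refl x xⁿ y yⁿ ⟩
    (x * y) * (xⁿ * yⁿ)  ≈⟨ *-cong xy≈1 (pow-inverse xy≈1 n) ⟩
    1# * 1#              ≈⟨ *-identityˡ 1# ⟩
    1#                   ∎
    where
    xⁿ yⁿ : Carrier
    xⁿ = pow F x n
    yⁿ = pow F y n

  Vect : Set → Set c
  Vect I = I → Carrier

  infix  4 _≋_
  infixl 6 _⊕_
  infixr 7 _·_

  _≋_ : ∀ {I} → Vect I → Vect I → Set ℓ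
  y ≋ z = ∀ i → y i ≈ z i

  _⊕_ : ∀ {I} → Vect I → Vect I → Vect I
  (y ⊕ z) i = y i + z i

  _·_ : ∀ {I} → Carrier → Vect I → Vect I
  (a · y) i = a * y i

  0ᵛ : ∀ {I} → Vect I
  0ᵛ _ = 0#

  ≋-trans : ∀ {I} {x y z : Vect I} → x ≋ y → y ≋ z → x ≋ z
  ≋-trans x≋y y≋z i = trans (x≋y i) (y≋z i)

  ≋-sym : ∀ {I} {x y : Vect I} → x ≋ y → y ≋ x
  ≋-sym x≋y i = sym (x≋y i)

  independent : ∀ {I} {A B : Vect I} (i j : I) →
    ¬ A i ≈ 0# → B i ≈ 0# → A j ≈ 0# → ¬ B j ≈ 0# →
    ∀ {α β α′ β′} → α · A ⊕ β · B ≋ α′ · A ⊕ β′ · B → α ≈ α′ × β ≈ β′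
  independent {A = A} {B} i j Aᵢ≉0 Bᵢ≈0 Aⱼ≈0 Bⱼ≉0 {α} {β} {α′} {β′} eq =
    *-cancelʳ Aᵢ≉0 (begin
      α * A i               ≈⟨ sym (dropʳ α β Bᵢ≈0) ⟩
      α * A i + β * B i     ≈⟨ eq i ⟩
      α′ * A i + β′ * B i   ≈⟨ dropʳ α′ β′ Bᵢ≈0 ⟩
      α′ * A i              ∎) ,
    *-cancelʳ Bⱼ≉0 (begin
      β * B j               ≈⟨ sym (dropˡ α β Aⱼ≈0) ⟩
      α * A j + β * B j     ≈⟨ eq j ⟩
      α′ * A j + β′ * B j   ≈⟨ dropˡ α′ β′ Aⱼ≈0 ⟩
      β′ * B j              ∎)
    where
    dropʳ : ∀ a b {x y} → y ≈ 0# → a * x + b * y ≈ a * x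
    dropʳ a b y≈0 = trans (+-cong refl (trans (*-cong refl y≈0) (zeroʳ b))) (+-identityʳ _)
    dropˡ : ∀ a b {x y} → x ≈ 0# → a * x + b * y ≈ b * y
    dropˡ a b x≈0 = trans (+-cong (trans (*-cong refl x≈0) (zeroʳ a)) refl) (+-identityˡ _)

  -- Abstract form of one map B̃ of a Billiard Array, read in coordinates in
  -- which the three lines involved are spanned by P, Q and R: a multiple
  -- α·P is sent to the multiple β·Q such that α·P + β·Q is a multiple of R,
  -- and this β exists, is unique, and equals ρ·α.
  record CliqueStep {I : Set} (P Q R : Vect I) (ρ : Carrier) : Set (c ⊔ ℓ) where
    field
      ρ-nonzero : ¬ ρ ≈ 0#
      forced    : ∀ {α β γ} → α · P ⊕ β · Q ≋ γ · R → β ≈ ρ * α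
      admitted  : ∀ α → ∃ λ γ → α · P ⊕ (ρ * α) · Q ≋ γ · R

  -- Any two of the three form a basis of the same plane, so
  -- B → A (completed by C), C → B (completed by A) and A → C (completed by B)
  -- are clique steps, with ratios κ⁻¹, -κ and -1.
  module Triangle {I : Set} (A B C : Vect I) {κ κ⁻¹ : Carrier} (κκ⁻¹≈1 : κ * κ⁻¹ ≈ 1#)
    (C≋A+κB : C ≋ A ⊕ κ · B)
    (coefficients : ∀ {α β α′ β′} → α · A ⊕ β · B ≋ α′ · A ⊕ β′ · B → α ≈ α′ × β ≈ β′)
    where

    coords-C : ∀ γ → γ · C ≋ γ · A ⊕ (γ * κ) · B
    coords-C γ i = trans (*-cong refl (C≋A+κB i))
      (solve 4 (λ γ a k b → γ :* (a :+ k :* b) := γ :* a :+ (γ :* k) :* b) refl γ (A i) κ (B i))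

    coords-BA : ∀ α β → α · B ⊕ β · A ≋ β · A ⊕ α · B
    coords-BA α β i = +-comm _ _

    coords-CB : ∀ α β → α · C ⊕ β · B ≋ α · A ⊕ (α * κ + β) · B
    coords-CB α β i = trans (+-cong (coords-C α i) refl)
      (solve 5 (λ α a k β b → (α :* a :+ (α :* k) :* b) :+ β :* b := α :* a :+ (α :* k :+ β) :* b)
             refl α (A i) κ β (B i))

    coords-AC : ∀ α β → α · A ⊕ β · C ≋ (α + β) · A ⊕ (β * κ) · B
    coords-AC α β i = trans (+-cong refl (coords-C β i))
      (solve 5 (λ α a β k b → α :* a :+ (β :* a :+ (β :* k) :* b) := (α :+ β) :* a :+ (β :* k) :* b)
             refl α (A i) β κ (B i))

    coords-cong : ∀ {α β α′ β′} → α ≈ α′ → β ≈ β′ → α · A ⊕ β · B ≋ α′ · A ⊕ β′ · B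
    coords-cong α≈α′ β≈β′ i = +-cong (*-cong α≈α′ refl) (*-cong β≈β′ refl)

    coords-A : ∀ γ → γ · A ⊕ 0# · B ≋ γ · A
    coords-A γ i = trans (+-cong refl (zeroˡ _)) (+-identityʳ _)

    coords-B : ∀ γ → 0# · A ⊕ γ · B ≋ γ · B
    coords-B γ i = trans (+-cong (zeroˡ _) refl) (+-identityˡ _)

    κ-nonzero : ¬ κ ≈ 0#
    κ-nonzero = invertible-nonzero κκ⁻¹≈1

    stepBA : CliqueStep B A C κ⁻¹
    stepBA = record
      { ρ-nonzero = invertible-nonzero (trans (*-comm κ⁻¹ κ) κκ⁻¹≈1)
      ; forced    = forced
      ; admitted  = λ α → κ⁻¹ * α , admitted α
      }
      where
      forced : ∀ {α β γ} → α · B ⊕ β · A ≋ γ · C → β ≈ κ⁻¹ * α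
      forced {α} {β} {γ} eq with coefficients (≋-trans (≋-sym (coords-BA α β)) (≋-trans eq (coords-C γ)))
      ... | β≈γ , α≈γκ = begin
        β                 ≈⟨ β≈γ ⟩
        γ                 ≈⟨ sym (*-identityʳ γ) ⟩
        γ * 1#            ≈⟨ *-cong refl (sym κκ⁻¹≈1) ⟩
        γ * (κ * κ⁻¹)     ≈⟨ solve 3 (λ γ k k' → γ :* (k :* k') := k' :* (γ :* k)) refl γ κ κ⁻¹ ⟩
        κ⁻¹ * (γ * κ)     ≈⟨ *-cong refl (sym α≈γκ) ⟩
        κ⁻¹ * α           ∎
      admitted : ∀ α → α · B ⊕ (κ⁻¹ * α) · A ≋ (κ⁻¹ * α) · C
      admitted α = ≋-trans (coords-BA α (κ⁻¹ * α))
        (≋-trans (coords-cong refl α≈ακ⁻¹κ) (≋-sym (coords-C (κ⁻¹ * α))))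
        where
        α≈ακ⁻¹κ : α ≈ (κ⁻¹ * α) * κ
        α≈ακ⁻¹κ = begin
          α                 ≈⟨ sym (*-identityˡ α) ⟩
          1# * α            ≈⟨ *-cong (sym κκ⁻¹≈1) refl ⟩
          (κ * κ⁻¹) * α     ≈⟨ solve 3 (λ k k' α → (k :* k') :* α := (k' :* α) :* k) refl κ κ⁻¹ α ⟩
          (κ⁻¹ * α) * κ     ∎

    stepCB : CliqueStep C B A (- κ)
    stepCB = record
      { ρ-nonzero = -‿nonzero κ-nonzero
      ; forced    = forced
      ; admitted  = λ α → α , admitted α
      }
      where
      ακ+[-κ]α≈0 : ∀ α → α * κ + (- κ) * α ≈ 0#
      ακ+[-κ]α≈0 α = trans (+-cong (*-comm α κ) (sym (-‿distribˡ-* κ α))) (-‿inverseʳ (κ * α))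
      forced : ∀ {α β γ} → α · C ⊕ β · B ≋ γ · A → β ≈ (- κ) * α
      forced {α} {β} {γ} eq with coefficients (≋-trans (≋-sym (coords-CB α β)) (≋-trans eq (≋-sym (coords-A γ))))
      ... | _ , ακ+β≈0 = begin
        β             ≈⟨ +-inverseʳ-unique (α * κ) β ακ+β≈0 ⟩
        - (α * κ)     ≈⟨ -‿cong (*-comm α κ) ⟩
        - (κ * α)     ≈⟨ -‿distribˡ-* κ α ⟩
        (- κ) * α     ∎
      admitted : ∀ α → α · C ⊕ ((- κ) * α) · B ≋ α · A
      admitted α = ≋-trans (coords-CB α ((- κ) * α)) (≋-trans (coords-cong refl (ακ+[-κ]α≈0 α)) (coords-A α))

    stepAC : CliqueStep A C B (- 1#)
    stepAC = record
      { ρ-nonzero = -‿nonzero (λ 1≈0 → 0≉1 (sym 1≈0))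
      ; forced    = forced
      ; admitted  = λ α → ((- 1#) * α) * κ , admitted α
      }
      where
      α+[-1]α≈0 : ∀ α → α + (- 1#) * α ≈ 0#
      α+[-1]α≈0 α = trans (+-cong refl (-1*x≈-x α)) (-‿inverseʳ α)
      forced : ∀ {α β γ} → α · A ⊕ β · C ≋ γ · B → β ≈ (- 1#) * α
      forced {α} {β} {γ} eq with coefficients (≋-trans (≋-sym (coords-AC α β)) (≋-trans eq (≋-sym (coords-B γ))))
      ... | α+β≈0 , _ = trans (+-inverseʳ-unique α β α+β≈0) (sym (-1*x≈-x α))
      admitted : ∀ α → α · A ⊕ ((- 1#) * α) · C ≋ (((- 1#) * α) * κ) · B
      admitted α = ≋-trans (coords-AC α ((- 1#) * α)) (≋-trans (coords-cong (α+[-1]α≈0 α) refl) (coords-B _))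

  -- Spans of initial segments of a sequence of generators e 0, e 1, … of
  -- ℕ-indexed vectors: Span e n y says y ∈ ⟨e 0, …, e (n-1)⟩.
  data Span (e : ℕ → Vect ℕ) : ℕ → Vect ℕ → Set (c ⊔ ℓ) where
    none : ∀ {y} → y ≋ 0ᵛ → Span e zero y
    more : ∀ {n y z} a → Span e n y → z ≋ y ⊕ a · e n → Span e (suc n) z

  module _ {e : ℕ → Vect ℕ} where

    span-cong : ∀ {n y z} → Span e n y → y ≋ z → Span e n z
    span-cong (none y≋0)       y≋z = none (≋-trans (≋-sym y≋z) y≋0)
    span-cong (more a sp z≋y′) y≋z = more a sp (≋-trans (≋-sym y≋z) z≋y′)

    span-0 : ∀ {n} → Span e n 0ᵛ
    span-0 {zero}  = none (λ _ → refl)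
    span-0 {suc n} = more 0# span-0 (λ i → sym (trans (+-identityˡ _) (zeroˡ _)))

    span-⊕ : ∀ {n y z} → Span e n y → Span e n z → Span e n (y ⊕ z)
    span-⊕ (none y≋0) (none z≋0) = none (λ i → trans (+-cong (y≋0 i) (z≋0 i)) (+-identityˡ 0#))
    span-⊕ {suc n} (more a sp y≋) (more b sp′ z≋) = more (a + b) (span-⊕ sp sp′) (λ i →
      trans (+-cong (y≋ i) (z≋ i))
        (solve 5 (λ y a v z b → (y :+ a :* v) :+ (z :+ b :* v) := (y :+ z) :+ (a :+ b) :* v)
               refl _ a (e n i) _ b))

    span-· : ∀ {n y} α → Span e n y → Span e n (α · y)
    span-· α (none y≋0) = none (λ i → trans (*-cong refl (y≋0 i)) (zeroʳ α))
    span-· {suc n} α (more a sp y≋) = more (α * a) (span-· α sp) (λ i →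
      trans (*-cong refl (y≋ i))
        (solve 4 (λ α y a v → α :* (y :+ a :* v) := α :* y :+ (α :* a) :* v) refl α _ a (e n i)))

    span-weaken : ∀ {n m y} → n ≤′ m → Span e n y → Span e m y
    span-weaken ≤′-refl        sp = sp
    span-weaken (≤′-step n≤′m) sp = more 0# (span-weaken n≤′m sp)
      (λ i → sym (trans (+-cong refl (zeroˡ _)) (+-identityʳ _)))

    span-gen : ∀ {k n} → k < n → Span e n (e k)
    span-gen k<n = span-weaken (ℕₚ.≤⇒≤′ k<n)
      (more 1# span-0 (λ i → sym (trans (+-identityˡ _) (*-identityˡ _))))

    span-sum : ∀ {n} m (v : Fin m → Vect ℕ) → (∀ j → Span e n (v j)) →
               Span e n (λ i → ∑[ j < m ] v j i)
    span-sum zero    v sp = span-0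
    span-sum (suc m) v sp = span-⊕ (sp Fin.zero) (span-sum m (λ j → v (Fin.suc j)) (λ j → sp (Fin.suc j)))

  record Linear (f : Vect ℕ → Vect ℕ) : Set (c ⊔ ℓ) where
    field
      f-cong : ∀ {y z} → y ≋ z → f y ≋ f z
      f-⊕    : ∀ y z → f (y ⊕ z) ≋ f y ⊕ f z
      f-·    : ∀ α y → f (α · y) ≋ α · f y

  span-map : ∀ {f} → Linear f → ∀ {e e′ n m} →
             (∀ k → k < n → Span e′ m (f (e k))) → ∀ {y} → Span e n y → Span e′ m (f y)
  span-map {f} lin gens {y} (none y≋0) = span-cong span-0 (λ i → sym (begin
    f y i          ≈⟨ f-cong (λ j → trans (y≋0 j) (sym (zeroˡ (y j)))) i ⟩
    f (0# · y) i   ≈⟨ f-· 0# y i ⟩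
    0# * f y i     ≈⟨ zeroˡ _ ⟩
    0#             ∎))
    where open Linear lin
  span-map {f} lin {e} {n = suc n} gens (more a sp z≋) =
    span-cong (span-⊕ (span-map lin (λ k k<n → gens k (ℕₚ.m≤n⇒m≤1+n k<n)) sp)
                      (span-· a (gens n ℕₚ.≤-refl)))
              (λ i → sym (trans (f-cong z≋ i) (trans (f-⊕ _ _ i) (+-cong refl (f-· a (e n) i)))))
    where open Linear lin

  span-vanish : ∀ {e} → (∀ k i → i < k → e k i ≈ 0#) → (∀ k → ¬ e k k ≈ 0#) →
                ∀ {n y} → Span e n y → (∀ i → i < n → y i ≈ 0#) → y ≋ 0ᵛ
  span-vanish below diag (none y≋0) _ = y≋0
  span-vanish {e} below diag {suc n} {z} (more {y = y} a sp z≋) z-low = z≋0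
    where
    y-low : ∀ i → i < n → y i ≈ 0#
    y-low i i<n = begin
      y i                ≈⟨ sym (+-identityʳ _) ⟩
      y i + 0#           ≈⟨ +-cong refl (sym (trans (*-cong refl (below n i i<n)) (zeroʳ a))) ⟩
      y i + a * e n i    ≈⟨ sym (z≋ i) ⟩
      z i                ≈⟨ z-low i (ℕₚ.m≤n⇒m≤1+n i<n) ⟩
      0#                 ∎
    y≋0 : y ≋ 0ᵛ
    y≋0 = span-vanish below diag sp y-low
    a≈0 : a ≈ 0#
    a≈0 = *-cancelʳ (diag n) (begin
      a * e n n          ≈⟨ sym (+-identityˡ _) ⟩
      0# + a * e n n     ≈⟨ +-cong (sym (y≋0 n)) refl ⟩
      y n + a * e n n    ≈⟨ sym (z≋ n) ⟩
      z n                ≈⟨ z-low n ℕₚ.≤-refl ⟩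
      0#                 ≈⟨ sym (zeroˡ _) ⟩
      0# * e n n         ∎)
    z≋0 : z ≋ 0ᵛ
    z≋0 i = trans (z≋ i) (trans (+-cong (y≋0 i) (trans (*-cong a≈0 refl) (zeroˡ _))) (+-identityˡ 0#))

  module UpperEchelon {e : ℕ → Vect ℕ} (o : ℕ)
    (above : ∀ k i → o +ℕ k < i → e k i ≈ 0#) (top : ∀ k → ¬ e k (o +ℕ k) ≈ 0#) where

    span-above : ∀ {n y} → Span e n y → ∀ i → o +ℕ n ≤ i → y i ≈ 0#
    span-above (none y≋0) i _ = y≋0 i
    span-above {suc n} (more a sp z≋) i o+n<i = trans (z≋ i)
      (trans (+-cong (span-above sp i (ℕₚ.<⇒≤ o+n<i′)) (trans (*-cong refl (above n i o+n<i′)) (zeroʳ a)))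
             (+-identityˡ 0#))
      where
      o+n<i′ : o +ℕ n < i
      o+n<i′ = ℕₚ.≤-trans (ℕₚ.≤-reflexive (≡.sym (ℕₚ.+-suc o n))) o+n<i

    span-peel : ∀ k {m y} → Span e (k +ℕ m) y → (∀ i → o +ℕ m ≤ i → y i ≈ 0#) → Span e m y
    span-peel zero    sp _ = sp
    span-peel (suc k) {m} {z} (more {y = y} a sp z≋) z-high = span-peel k (span-cong sp y≋z) z-high
      where
      j : ℕ
      j = o +ℕ (k +ℕ m)
      a≈0 : a ≈ 0#
      a≈0 = *-cancelʳ (top (k +ℕ m)) (begin
        a * e (k +ℕ m) j           ≈⟨ sym (+-identityˡ _) ⟩
        0# + a * e (k +ℕ m) j      ≈⟨ +-cong (sym (span-above sp j ℕₚ.≤-refl)) refl ⟩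
        y j + a * e (k +ℕ m) j     ≈⟨ sym (z≋ j) ⟩
        z j                        ≈⟨ z-high j (ℕₚ.+-monoʳ-≤ o (ℕₚ.m≤n+m m k)) ⟩
        0#                         ≈⟨ sym (zeroˡ _) ⟩
        0# * e (k +ℕ m) j          ∎)
      y≋z : y ≋ z
      y≋z i = sym (trans (z≋ i) (trans (+-cong refl (trans (*-cong a≈0 refl) (zeroˡ _))) (+-identityʳ _)))

module GaussianColumns {c ℓ : Level} (F : Field c ℓ) (q ι : Field.Carrier F)
  (qι≈1 : Field._≈_ F (Field._*_ F q ι) (Field.1# F)) where
  open Field F hiding (zero)
  open LinearAlgebra F
  open import Relation.Binary.Reasoning.Setoid setoid
  open import Algebra.Solver.Ring.NaturalCoefficients.Default commutativeSemiring
  open import Algebra.Properties.Ring ring using (-‿distribˡ-*; xyx⁻¹≈y)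

  q^_ ι^_ : ℕ → Carrier
  q^ n = pow F q n
  ι^ n = pow F ι n

  ι-nonzero : ¬ ι ≈ 0#
  ι-nonzero = invertible-nonzero (trans (*-comm ι q) qι≈1)

  qbinom : ℕ → ℕ → Carrier
  qbinom = gauss F q

  qbinom-vanish : ∀ n k → n < k → qbinom n k ≈ 0#
  qbinom-vanish zero    (suc k) _         = refl
  qbinom-vanish (suc n) (suc k) (s≤s n<k) = begin
    qbinom n k + q^ (suc k) * qbinom n (suc k)
      ≈⟨ +-cong (qbinom-vanish n k n<k) (*-cong refl (qbinom-vanish n (suc k) (ℕₚ.m≤n⇒m≤1+n n<k))) ⟩
    0# + q^ (suc k) * 0#  ≈⟨ solve 1 (λ a → con 0 :+ a :* con 0 := con 0) refl (q^ (suc k)) ⟩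
    0#                    ∎

  qbinom-diag : ∀ n → qbinom n n ≈ 1#
  qbinom-diag zero    = refl
  qbinom-diag (suc n) = begin
    qbinom n n + q^ (suc n) * qbinom n (suc n)
      ≈⟨ +-cong (qbinom-diag n) (*-cong refl (qbinom-vanish n (suc n) (ℕₚ.n<1+n n))) ⟩
    1# + q^ (suc n) * 0#  ≈⟨ solve 1 (λ a → con 1 :+ a :* con 0 := con 1) refl (q^ (suc n)) ⟩
    1#                    ∎

  -- The second q-Pascal rule [j+1, k+1] = [j, k+1] + q^(j-k) [j, k], with
  -- q^(j-k) written as q^j ι^k so that no subtraction of exponents is needed.
  qbinom-pascal′ : ∀ j k → qbinom (suc j) (suc k) ≈ qbinom j (suc k) + q^ j * (ι^ k * qbinom j k)
  qbinom-pascal′ zero zero =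
    solve 1 (λ q → con 1 :+ (q :* con 1) :* con 0 := con 0 :+ con 1 :* (con 1 :* con 1)) refl q
  qbinom-pascal′ zero (suc k) =
    solve 2 (λ a b → con 0 :+ a :* con 0 := con 0 :+ con 1 :* (b :* con 0)) refl (q^ (suc (suc k))) (ι^ (suc k))
  qbinom-pascal′ (suc n) zero = begin
    1# + (q * 1#) * qbinom (suc n) 1
      ≈⟨ +-cong refl (*-cong refl (qbinom-pascal′ n zero)) ⟩
    1# + (q * 1#) * (qbinom n 1 + q^ n * (1# * 1#))
      ≈⟨ solve 3 (λ q b Q → con 1 :+ (q :* con 1) :* (b :+ Q :* (con 1 :* con 1))
                          := (con 1 :+ (q :* con 1) :* b) :+ (q :* Q) :* (con 1 :* con 1)) refl q (qbinom n 1) (q^ n) ⟩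
    (1# + (q * 1#) * qbinom n 1) + (q * q^ n) * (1# * 1#) ∎
  qbinom-pascal′ (suc n) (suc k) = begin
    qbinom (suc n) (suc k) + (q * K) * qbinom (suc n) (suc (suc k))
      ≈⟨ +-cong (qbinom-pascal′ n k) (*-cong refl (qbinom-pascal′ n (suc k))) ⟩
    (b + Q * (I * a)) + (q * K) * (b′ + Q * ((ι * I) * b))
      ≈⟨ +-cong (+-cong refl (trans (sym (*-identityˡ _)) (*-cong (sym qι≈1) refl))) refl ⟩
    (b + (q * ι) * (Q * (I * a))) + (q * K) * (b′ + Q * ((ι * I) * b))
      ≈⟨ solve 8 (λ q ι Q I a b b′ K →
             (b :+ (q :* ι) :* (Q :* (I :* a))) :+ (q :* K) :* (b′ :+ Q :* ((ι :* I) :* b))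
          := (b :+ (q :* K) :* b′) :+ (q :* Q) :* ((ι :* I) :* (a :+ K :* b))) refl q ι Q I a b b′ K ⟩
    (b + (q * K) * b′) + (q * Q) * ((ι * I) * (a + K * b)) ∎
    where
    K Q I a b b′ : Carrier
    K = q^ (suc k)
    Q = q^ n
    I = ι^ k
    a = qbinom n k
    b = qbinom n (suc k)
    b′ = qbinom n (suc (suc k))

  column : ℕ → Vect ℕ
  column j i = qbinom j i

  shift : Vect ℕ → Vect ℕ
  shift y zero    = 0#
  shift y (suc i) = ι^ i * y i

  shift-linear : Linear shift
  shift-linear = record { f-cong = f-cong ; f-⊕ = f-⊕ ; f-· = f-· }
    where
    f-cong : ∀ {y z} → y ≋ z → shift y ≋ shift z
    f-cong y≋z zero    = refl
    f-cong y≋z (suc i) = *-cong refl (y≋z i)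
    f-⊕ : ∀ y z → shift (y ⊕ z) ≋ shift y ⊕ shift z
    f-⊕ y z zero    = sym (+-identityˡ 0#)
    f-⊕ y z (suc i) = distribˡ _ _ _
    f-· : ∀ α y → shift (α · y) ≋ α · shift y
    f-· α y zero    = sym (zeroʳ α)
    f-· α y (suc i) = solve 3 (λ I α x → I :* (α :* x) := α :* (I :* x)) refl (ι^ i) α (y i)

  -- line s t spans B_(r,s,t) of b(T) (for every r): the t-th column shifted s times.
  line : ℕ → ℕ → Vect ℕ
  line zero    t = column t
  line (suc s) t = shift (line s t)

  -- The linear relation among the three lines of a black 3-clique.
  line-pascal : ∀ s t → line s (suc t) ≋ line s t ⊕ q^ t · line (suc s) t
  line-pascal zero    t zero    = solve 1 (λ a → con 1 := con 1 :+ a :* con 0) refl (q^ t)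
  line-pascal zero    t (suc k) = qbinom-pascal′ t k
  line-pascal (suc s) t zero    = solve 1 (λ a → con 0 := con 0 :+ a :* con 0) refl (q^ t)
  line-pascal (suc s) t (suc k) = begin
    ι^ k * line s (suc t) k                          ≈⟨ *-cong refl (line-pascal s t k) ⟩
    ι^ k * (line s t k + q^ t * line (suc s) t k)
      ≈⟨ solve 4 (λ I a Q b → I :* (a :+ Q :* b) := I :* a :+ Q :* (I :* b)) refl (ι^ k) (line s t k) (q^ t) (line (suc s) t k) ⟩
    ι^ k * line s t k + q^ t * (ι^ k * line (suc s) t k) ∎

  line-below : ∀ s t i → i < s → line s t i ≈ 0#
  line-below (suc s) t zero    _         = refl
  line-below (suc s) t (suc i) (s≤s i<s) = trans (*-cong refl (line-below s t i i<s)) (zeroʳ _)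

  line-above : ∀ s t i → s +ℕ t < i → line s t i ≈ 0#
  line-above zero    t i       t<i         = qbinom-vanish t i t<i
  line-above (suc s) t (suc i) (s≤s s+t<i) = trans (*-cong refl (line-above s t i s+t<i)) (zeroʳ _)

  line-bottom : ∀ s t → ¬ line s t s ≈ 0#
  line-bottom zero    t 1≈0 = 0≉1 (sym 1≈0)
  line-bottom (suc s) t     = *-nonzero (pow-nonzero s ι-nonzero) (line-bottom s t)

  line-top : ∀ s t → ¬ line s t (s +ℕ t) ≈ 0#
  line-top zero    t t≈0 = 0≉1 (sym (trans (sym (qbinom-diag t)) t≈0))
  line-top (suc s) t     = *-nonzero (pow-nonzero (s +ℕ t) ι-nonzero) (line-top s t)

  columns-from : ℕ → ℕ → Vect ℕ
  columns-from t k = column (t +ℕ k)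

  lines-from : ℕ → ℕ → Vect ℕ
  lines-from t k = line k t

  ≡⇒≋ : ∀ {y z : Vect ℕ} → y ≡ z → y ≋ z
  ≡⇒≋ ≡.refl i = refl

  column-shifted : ∀ t k → column (t +ℕ suc k) ≋ column (suc (t +ℕ k))
  column-shifted t k = ≡⇒≋ (≡.cong column (ℕₚ.+-suc t k))

  shift-column : ∀ j → shift (column j) ≋ ι^ j · column (suc j) ⊕ (- ι^ j) · column j
  shift-column j i = sym (begin
    I * column (suc j) i + (- I) * column j i
      ≈⟨ +-cong (*-cong refl (line-pascal 0 j i)) (sym (-‿distribˡ-* I _)) ⟩
    I * (column j i + q^ j * s) + - (I * column j i)
      ≈⟨ +-cong (solve 4 (λ I c Q s → I :* (c :+ Q :* s) := I :* c :+ (Q :* I) :* s) refl I (column j i) (q^ j) s) refl ⟩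
    (I * column j i + (q^ j * I) * s) + - (I * column j i)  ≈⟨ xyx⁻¹≈y _ _ ⟩
    (q^ j * I) * s                                           ≈⟨ *-cong (pow-inverse qι≈1 j) refl ⟩
    1# * s                                                   ≈⟨ *-identityˡ s ⟩
    s                                                        ∎)
    where
    I s : Carrier
    I = ι^ j
    s = shift (column j) i

  shift-columns : ∀ {t n y} → Span (columns-from t) n y → Span (columns-from t) (suc n) (shift y)
  shift-columns {t} = span-map shift-linear λ k k<n →
    span-cong (span-⊕ (span-· (ι^ (t +ℕ k)) (span-cong (span-gen (s≤s k<n)) (column-shifted t k)))
                      (span-· (- ι^ (t +ℕ k)) (span-gen (ℕₚ.m≤n⇒m≤1+n k<n))))
              (≋-sym (shift-column (t +ℕ k)))

  shift-lines : ∀ {t n y} → Span (lines-from t) n y → Span (lines-from t) (suc n) (shift y)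
  shift-lines = span-map shift-linear λ k k<n → span-gen (s≤s k<n)

  column-t : ∀ t → column t ≋ columns-from t 0
  column-t t = ≡⇒≋ (≡.cong column (≡.sym (ℕₚ.+-identityʳ t)))

  line-in-columns : ∀ s t → Span (columns-from t) (suc s) (line s t)
  line-in-columns zero    t = span-cong (span-gen (s≤s z≤n)) (≋-sym (column-t t))
  line-in-columns (suc s) t = shift-columns (line-in-columns s t)

  column-in-lines : ∀ t k → Span (lines-from t) (suc k) (columns-from t k)
  column-in-lines t zero    = span-cong (span-gen (s≤s z≤n)) (column-t t)
  column-in-lines t (suc k) = span-cong
    (span-⊕ (span-weaken (≤′-step ≤′-refl) (column-in-lines t k))
            (span-· (q^ (t +ℕ k)) (shift-lines (column-in-lines t k))))
    (≋-sym (≋-trans (column-shifted t k) (line-pascal 0 (t +ℕ k))))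

  columns⊆lines : ∀ {t n y} → Span (columns-from t) n y → Span (lines-from t) n y
  columns⊆lines {t} = span-map id-linear (λ k k<n → span-weaken (ℕₚ.≤⇒≤′ k<n) (column-in-lines t k))
    where
    id-linear : Linear (λ y → y)
    id-linear = record { f-cong = λ y≋z → y≋z ; f-⊕ = λ _ _ _ → refl ; f-· = λ _ _ _ → refl }

  module ColumnEchelon (t : ℕ) = UpperEchelon {columns-from t} t
    (λ k i t+k<i → qbinom-vanish (t +ℕ k) i t+k<i)
    (λ k 1≈0 → 0≉1 (sym (trans (sym (qbinom-diag (t +ℕ k))) 1≈0)))

  on-line : ∀ {s t y} → Span (columns-from t) (suc s) y → (∀ i → i < s → y i ≈ 0#) →
            ∃ λ α → y ≋ α · line s t
  on-line {s} {t} {y} sp y-low with columns⊆lines sp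
  ... | more {y = y′} α sp′ y≋ = α , λ i → trans (y≋ i) (trans (+-cong (y′≋0 i) refl) (+-identityˡ _))
    where
    y′-low : ∀ i → i < s → y′ i ≈ 0#
    y′-low i i<s = begin
      y′ i                   ≈⟨ sym (+-identityʳ _) ⟩
      y′ i + 0#              ≈⟨ +-cong refl (sym (trans (*-cong refl (line-below s t i i<s)) (zeroʳ α))) ⟩
      y′ i + α * line s t i  ≈⟨ sym (y≋ i) ⟩
      y i                    ≈⟨ y-low i i<s ⟩
      0#                     ∎
    y′≋0 : y′ ≋ 0ᵛ
    y′≋0 = span-vanish (λ k i → line-below k t i) (λ k → line-bottom k t) sp′ y′-low

module Model {c ℓ : Level} (F : Field c ℓ) (q ι : Field.Carrier F)
  (qι≈1 : Field._≈_ F (Field._*_ F q ι) (Field.1# F)) (d : ℕ) where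
  open Field F hiding (zero)
  open LinearAlgebra F
  open GaussianColumns F q ι qι≈1
  open import Relation.Binary.Reasoning.Setoid setoid
  open import Algebra.Solver.Ring.NaturalCoefficients.Default commutativeSemiring
  open import Algebra.Properties.Semiring.Sum semiring
    using (sum; sum-syntax; sum-cong-≋; sum-replicate-zero; ∑-distrib-+; *-distribˡ-sum)

  Coords : Set c
  Coords = Vect (Fin (suc d))

  restrict : Vect ℕ → Coords
  restrict y i = y (toℕ i)

  restrict-at : ∀ {n} (n≤d : n < suc d) v → restrict v (fromℕ< n≤d) ≈ v n
  restrict-at n≤d v = reflexive (≡.cong v (Finₚ.toℕ-fromℕ< n≤d))

  -- T x, extended by zeros beyond row d.
  image : Coords → Vect ℕ
  image x i = ∑[ j < suc d ] (column (toℕ j) i * x j)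

  sum-zero : ∀ n (f : Fin n → Carrier) → (∀ j → f j ≈ 0#) → sum f ≈ 0#
  sum-zero n f f≈0 = trans (sum-cong-≋ f≈0) (sum-replicate-zero n)

  image-above : ∀ x i → d < i → image x i ≈ 0#
  image-above x i d<i = sum-zero (suc d) _ term≈0
    where
    term≈0 : ∀ j → column (toℕ j) i * x j ≈ 0#
    term≈0 j = trans (*-cong (qbinom-vanish (toℕ j) i (ℕₚ.≤-<-trans (ℕₚ.≤-pred (Finₚ.toℕ<n j)) d<i)) refl)
                     (zeroˡ (x j))

  image-linear : ∀ x a x′ → image (x ⊕ a · x′) ≋ image x ⊕ a · image x′
  image-linear x a x′ i = begin
    ∑[ j < suc d ] (column (toℕ j) i * (x j + a * x′ j))
      ≈⟨ sum-cong-≋ (λ j → solve 4 (λ g u a v → g :* (u :+ a :* v) := g :* u :+ a :* (g :* v))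
                                   refl (column (toℕ j) i) (x j) a (x′ j)) ⟩
    ∑[ j < suc d ] (column (toℕ j) i * x j + a * (column (toℕ j) i * x′ j))
      ≈⟨ ∑-distrib-+ (λ j → column (toℕ j) i * x j) (λ j → a * (column (toℕ j) i * x′ j)) ⟩
    image x i + ∑[ j < suc d ] (a * (column (toℕ j) i * x′ j))
      ≈⟨ +-cong refl (sym (*-distribˡ-sum a (λ j → column (toℕ j) i * x′ j))) ⟩
    image x i + a * image x′ i ∎

  δ : ℕ → ℕ → Carrier
  δ zero    zero    = 1#
  δ zero    (suc _) = 0#
  δ (suc _) zero    = 0#
  δ (suc a) (suc b) = δ a b

  δ-below : ∀ a b → a < b → δ a b ≈ 0#
  δ-below zero    (suc b) _         = refl
  δ-below (suc a) (suc b) (s≤s a<b) = δ-below a b a<b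

  unit : ℕ → Coords
  unit k j = δ (toℕ j) k

  sum-δ : ∀ n (f : ℕ → Carrier) k → k < n → ∑[ j < n ] (f (toℕ j) * δ (toℕ j) k) ≈ f k
  sum-δ (suc n) f zero _ = begin
    f 0 * 1# + ∑[ j < n ] (f (suc (toℕ j)) * 0#)  ≈⟨ +-cong (*-identityʳ _) (sum-zero n _ (λ j → zeroʳ _)) ⟩
    f 0 + 0#                                       ≈⟨ +-identityʳ _ ⟩
    f 0                                            ∎
  sum-δ (suc n) f (suc k) (s≤s k<n) = begin
    f 0 * 0# + ∑[ j < n ] (f (suc (toℕ j)) * δ (toℕ j) k)  ≈⟨ +-cong (zeroʳ _) (sum-δ n (λ m → f (suc m)) k k<n) ⟩
    0# + f (suc k)                                          ≈⟨ +-identityˡ _ ⟩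
    f (suc k)                                               ∎

  image-unit : ∀ k → k < suc d → image (unit k) ≋ column k
  image-unit k k≤d i = sum-δ (suc d) (λ j → column j i) k k≤d

  StartsAt : ℕ → Coords → Set ℓ
  StartsAt t x = ∀ j → toℕ j < t → x j ≈ 0#

  image-in-columns : ∀ {t n x} → StartsAt t x → d < t +ℕ n → Span (columns-from t) n (image x)
  image-in-columns {t} {n} {x} x-from d<t+n = span-sum (suc d) _ term
    where
    term : ∀ j → Span (columns-from t) n (λ i → column (toℕ j) i * x j)
    term j with toℕ j <? t
    ... | yes j<t = span-cong span-0 (λ i → sym (trans (*-cong refl (x-from j j<t)) (zeroʳ _)))
    ... | no  j≮t = span-cong (span-· (x j) generator) (λ i → *-comm _ _)
      where
      t≤j : t ≤ toℕ j
      t≤j = ℕₚ.≮⇒≥ j≮t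
      j<t+n : toℕ j < t +ℕ n
      j<t+n = ℕₚ.≤-<-trans (ℕₚ.≤-pred (Finₚ.toℕ<n j)) d<t+n
      generator : Span (columns-from t) n (column (toℕ j))
      generator = span-cong (span-gen (ℕₚ.+-cancelˡ-< t _ _ (≡.subst (_< t +ℕ n) (≡.sym (ℕₚ.m+[n∸m]≡n t≤j)) j<t+n)))
                            (≡⇒≋ (≡.cong column (ℕₚ.m+[n∸m]≡n t≤j)))

  columns-in-image : ∀ {t n y} → Span (columns-from t) n y → t +ℕ n ≤ suc d →
                     ∃ λ x → StartsAt t x × y ≋ image x
  columns-in-image (none y≋0) _ =
    0ᵛ , (λ _ _ → refl) , (λ i → trans (y≋0 i) (sym (sum-zero (suc d) _ (λ j → zeroʳ (column (toℕ j) i)))))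
  columns-in-image {t} {suc n} {z} (more a sp z≋) t+n<d+1
    with columns-in-image sp (ℕₚ.≤-trans (ℕₚ.+-monoʳ-≤ t (ℕₚ.n≤1+n n)) t+n<d+1)
  ... | x , x-from , y≋Tx = x ⊕ a · unit (t +ℕ n) , x′-from , z≋Tx′
    where
    x′-from : StartsAt t (x ⊕ a · unit (t +ℕ n))
    x′-from j j<t = trans (+-cong (x-from j j<t)
      (trans (*-cong refl (δ-below (toℕ j) (t +ℕ n) (ℕₚ.<-≤-trans j<t (ℕₚ.m≤m+n t n)))) (zeroʳ a)))
      (+-identityˡ 0#)
    z≋Tx′ : z ≋ image (x ⊕ a · unit (t +ℕ n))
    z≋Tx′ i = begin
      z i                                   ≈⟨ z≋ i ⟩
      _ + a * column (t +ℕ n) i             ≈⟨ +-cong (y≋Tx i) (*-cong refl (sym (image-unit (t +ℕ n) t+n≤d i))) ⟩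
      image x i + a * image (unit (t +ℕ n)) i ≈⟨ sym (image-linear x a (unit (t +ℕ n)) i) ⟩
      image (x ⊕ a · unit (t +ℕ n)) i       ∎
      where
      t+n≤d : t +ℕ n < suc d
      t+n≤d = ≡.subst (_≤ suc d) (ℕₚ.+-suc t n) t+n<d+1

  -- The location (r, s, t) of b(T) with r = d - s - t, in coordinates:
  -- y ∈ U_{s+t} ∩ U'_{d-s} ∩ U''_{d-t}.
  record InModel (s t : ℕ) (y : Coords) : Set (c ⊔ ℓ) where
    field
      vanish-above  : ∀ i → s +ℕ t < toℕ i → y i ≈ 0#
      vanish-below  : ∀ i → toℕ i < s → y i ≈ 0#
      preimage      : Coords
      preimage-from : StartsAt t preimage
      is-image      : y ≋ restrict (image preimage)

  private
    t+[1+s]≡1+[s+t] : ∀ s t → t +ℕ suc s ≡ suc (s +ℕ t)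
    t+[1+s]≡1+[s+t] = solve-∀
    t+[k+[1+s]]≡1+[k+[s+t]] : ∀ s t k → t +ℕ (k +ℕ suc s) ≡ suc (k +ℕ (s +ℕ t))
    t+[k+[1+s]]≡1+[k+[s+t]] = solve-∀

  line-in-model : ∀ s t → s +ℕ t ≤ d → ∀ α → InModel s t (α · restrict (line s t))
  line-in-model s t s+t≤d α with columns-in-image (span-· α (line-in-columns s t))
                                  (≡.subst (_≤ suc d) (≡.sym (t+[1+s]≡1+[s+t] s t)) (s≤s s+t≤d))
  ... | x , x-from , αline≋Tx = record
    { vanish-above  = λ i s+t<i → trans (*-cong refl (line-above s t (toℕ i) s+t<i)) (zeroʳ α)
    ; vanish-below  = λ i i<s → trans (*-cong refl (line-below s t (toℕ i) i<s)) (zeroʳ α)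
    ; preimage      = x
    ; preimage-from = x-from
    ; is-image      = λ i → αline≋Tx (toℕ i)
    }

  model-on-line : ∀ {s t y} → s +ℕ t ≤ d → InModel s t y → ∃ λ α → y ≋ α · restrict (line s t)
  model-on-line {s} {t} {y} s+t≤d m = α , λ i → trans (is-image i) (Tx≋αline (toℕ i))
    where
    open InModel m
    Tx : Vect ℕ
    Tx = image preimage
    k : ℕ
    k = d ∸ (s +ℕ t)

    Tx-at : ∀ {i} (i≤d : i < suc d) → Tx i ≈ y (fromℕ< i≤d)
    Tx-at i≤d = sym (trans (is-image (fromℕ< i≤d)) (restrict-at i≤d Tx))

    Tx-low : ∀ i → i < s → Tx i ≈ 0#
    Tx-low i i<s = trans (Tx-at i≤d) (vanish-below _ (≡.subst (_< s) (≡.sym (Finₚ.toℕ-fromℕ< i≤d)) i<s))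
      where
      i≤d : i < suc d
      i≤d = ℕₚ.<-≤-trans i<s (ℕₚ.m≤n⇒m≤1+n (ℕₚ.≤-trans (ℕₚ.m≤m+n s t) s+t≤d))

    Tx-high : ∀ i → t +ℕ suc s ≤ i → Tx i ≈ 0#
    Tx-high i t+s<i with i <? suc d
    ... | yes i≤d = trans (Tx-at i≤d) (vanish-above _ (≡.subst (s +ℕ t <_) (≡.sym (Finₚ.toℕ-fromℕ< i≤d)) s+t<i))
      where
      s+t<i : s +ℕ t < i
      s+t<i = ≡.subst (_≤ i) (t+[1+s]≡1+[s+t] s t) t+s<i
    ... | no  i≰d = image-above preimage i (ℕₚ.≤-pred (ℕₚ.≰⇒> i≰d))

    d<t+[k+[1+s]] : d < t +ℕ (k +ℕ suc s)
    d<t+[k+[1+s]] = ≡.subst (d <_) (≡.sym (≡.trans (t+[k+[1+s]]≡1+[k+[s+t]] s t k) (≡.cong suc (ℕₚ.m∸n+n≡m s+t≤d))))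
                             ℕₚ.≤-refl

    in-columns : Span (columns-from t) (suc s) Tx
    in-columns = ColumnEchelon.span-peel t k (image-in-columns preimage-from d<t+[k+[1+s]]) Tx-high

    α : Carrier
    α = proj₁ (on-line in-columns Tx-low)
    Tx≋αline : Tx ≋ α · line s t
    Tx≋αline = proj₂ (on-line in-columns Tx-low)

  -- Inside F^{d+1}, line s t and line (s+1) t are independent (the first starts
  -- earlier, the second ends later) …
  line-coefficients : ∀ s t → s +ℕ suc t ≤ d → ∀ {α β α′ β′} →
    α · restrict (line s t) ⊕ β · restrict (line (suc s) t) ≋ α′ · restrict (line s t) ⊕ β′ · restrict (line (suc s) t) →
    α ≈ α′ × β ≈ β′
  line-coefficients s t s+t<d = independent (fromℕ< s≤d) (fromℕ< top≤d)
    (λ A≈0 → line-bottom s t (trans (sym (restrict-at s≤d (line s t))) A≈0))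
    (trans (restrict-at s≤d (line (suc s) t)) (line-below (suc s) t s (ℕₚ.n<1+n s)))
    (trans (restrict-at top≤d (line s t)) (line-above s t (suc (s +ℕ t)) (ℕₚ.n<1+n _)))
    (λ B≈0 → line-top (suc s) t (trans (sym (restrict-at top≤d (line (suc s) t))) B≈0))
    where
    top≤d : suc (s +ℕ t) < suc d
    top≤d = s≤s (≡.subst (_≤ d) (ℕₚ.+-suc s t) s+t<d)
    s≤d : s < suc d
    s≤d = ℕₚ.≤-<-trans (ℕₚ.m≤m+n s t) (ℕₚ.<-trans (ℕₚ.n<1+n _) top≤d)

  module CliqueTriangle (s t : ℕ) (s+t<d : s +ℕ suc t ≤ d) = Triangle
    (restrict (line s t)) (restrict (line (suc s) t)) (restrict (line s (suc t)))
    (pow-inverse qι≈1 t) (λ i → line-pascal s t (toℕ i)) (line-coefficients s t s+t<d)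

-- The six locations around τ = (r,s,t) ∈ Δ_{d-2}: λ, μ, ν, and the third
-- points of the black 3-cliques through λμ, μν and νλ, all lie in Δ_d.
λ-sum : ∀ r s t → r +ℕ suc s +ℕ suc t ≡ r +ℕ s +ℕ t +ℕ 2
λ-sum = solve-∀
μ-sum : ∀ r s t → suc r +ℕ s +ℕ suc t ≡ r +ℕ s +ℕ t +ℕ 2
μ-sum = solve-∀
ν-sum : ∀ r s t → suc r +ℕ suc s +ℕ t ≡ r +ℕ s +ℕ t +ℕ 2
ν-sum = solve-∀
λμ-sum : ∀ r s t → r +ℕ s +ℕ suc (suc t) ≡ r +ℕ s +ℕ t +ℕ 2
λμ-sum = solve-∀
μν-sum : ∀ r s t → suc (suc r) +ℕ s +ℕ t ≡ r +ℕ s +ℕ t +ℕ 2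
μν-sum = solve-∀
νλ-sum : ∀ r s t → r +ℕ suc (suc s) +ℕ t ≡ r +ℕ s +ℕ t +ℕ 2
νλ-sum = solve-∀

module BilliardArray {c ℓ m ℓm p : Level} (F : Field c ℓ) (d : ℕ) (q ι : Field.Carrier F)
  (qι≈1 : Field._≈_ F (Field._*_ F q ι) (Field.1# F))
  (V : Module (Field.commutativeRing F) m ℓm) (B : ℕ → ℕ → ℕ → Module.Carrierᴹ V → Set p)
  (iso : IsoToBT F V d (Tq F d q) B) where
  open Field F hiding (zero)
  open LinearAlgebra F
  open GaussianColumns F q ι qι≈1
  open Model F q ι qι≈1 d
  open Module V using (Carrierᴹ; _≈ᴹ_; _+ᴹ_; _*ₗ_; 0ᴹ; ≈ᴹ-sym; *ₗ-zeroˡ)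
  open import Relation.Binary.Reasoning.Setoid setoid
  open import Algebra.Properties.Semiring.Sum semiring using (sum; sum-cong-≋)
  open import Algebra.Properties.Ring ring using (-1*x≈-x; -‿distribˡ-*; -‿involutive)
  open import Algebra.Solver.Ring.NaturalCoefficients.Default commutativeSemiring

  σ : Carrierᴹ → Coords
  σ = proj₁ iso
  open IsLinearBijection (proj₁ (proj₂ iso))

  σ-in-B : ∀ {r s t} → r +ℕ s +ℕ t ≡ d → ∀ y → B r s t y → BT F d (Tq F d q) r s t (σ y)
  σ-in-B {r} {s} {t} e y = proj₁ (proj₂ (proj₂ iso) r s t e y)

  σ-from-B : ∀ {r s t} → r +ℕ s +ℕ t ≡ d → ∀ y → BT F d (Tq F d q) r s t (σ y) → B r s t y
  σ-from-B {r} {s} {t} e y = proj₂ (proj₂ (proj₂ iso) r s t e y)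

  T-entry : ∀ i j → Tq F d q i j ≈ column (toℕ j) (toℕ i)
  T-entry i j with toℕ i ≤ᵇ toℕ j in i≤ᵇj
  ... | true  = refl
  ... | false = sym (qbinom-vanish (toℕ j) (toℕ i) (ℕₚ.≰⇒> (λ i≤j → ≡.subst T i≤ᵇj (ℕₚ.≤⇒≤ᵇ i≤j))))

  sumF≡sum : ∀ n (f : Fin n → Carrier) → sumF F n f ≡ sum f
  sumF≡sum zero    f = ≡.refl
  sumF≡sum (suc n) f = ≡.cong (f Fin.zero +_) (sumF≡sum n (λ j → f (Fin.suc j)))

  T-image : ∀ x i → sumF F (suc d) (λ j → Tq F d q i j * x j) ≈ image x (toℕ i)
  T-image x i = trans (reflexive (sumF≡sum (suc d) (λ j → Tq F d q i j * x j)))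
                      (sum-cong-≋ (λ j → *-cong (T-entry i j) (refl {x j})))

  module Location {r s t : ℕ} (r+s+t≡d : r +ℕ s +ℕ t ≡ d) where
    s+t≤d : s +ℕ t ≤ d
    s+t≤d = ≡.subst (s +ℕ t ≤_) (≡.trans (≡.sym (ℕₚ.+-assoc r s t)) r+s+t≡d) (ℕₚ.m≤n+m (s +ℕ t) r)

    d∸r≡s+t : d ∸ r ≡ s +ℕ t
    d∸r≡s+t = ≡.trans (≡.cong (_∸ r) (≡.sym (≡.trans (≡.sym (ℕₚ.+-assoc r s t)) r+s+t≡d))) (ℕₚ.m+n∸m≡n r (s +ℕ t))

    d∸[d∸s]≡s : d ∸ (d ∸ s) ≡ s
    d∸[d∸s]≡s = ℕₚ.m∸[m∸n]≡n (ℕₚ.≤-trans (ℕₚ.m≤m+n s t) s+t≤d)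

    d∸[d∸t]≡t : d ∸ (d ∸ t) ≡ t
    d∸[d∸t]≡t = ℕₚ.m∸[m∸n]≡n (ℕₚ.≤-trans (ℕₚ.m≤n+m t s) s+t≤d)

    BT⇒InModel : ∀ {y} → BT F d (Tq F d q) r s t y → InModel s t y
    BT⇒InModel (in-U , in-U′ , x , x-from , y≈Tx) = record
      { vanish-above  = λ i s+t<i → in-U i (≡.subst (_< toℕ i) (≡.sym d∸r≡s+t) s+t<i)
      ; vanish-below  = λ i i<s → in-U′ i (≡.subst (toℕ i <_) (≡.sym d∸[d∸s]≡s) i<s)
      ; preimage      = x
      ; preimage-from = λ j j<t → x-from j (≡.subst (toℕ j <_) (≡.sym d∸[d∸t]≡t) j<t)
      ; is-image      = λ i → trans (y≈Tx i) (T-image x i)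
      }

    InModel⇒BT : ∀ {y} → InModel s t y → BT F d (Tq F d q) r s t y
    InModel⇒BT m =
      (λ i d∸r<i → vanish-above i (≡.subst (_< toℕ i) d∸r≡s+t d∸r<i)) ,
      (λ i i<d∸[d∸s] → vanish-below i (≡.subst (toℕ i <_) d∸[d∸s]≡s i<d∸[d∸s])) ,
      preimage , (λ j j<d∸[d∸t] → preimage-from j (≡.subst (toℕ j <_) d∸[d∸t]≡t j<d∸[d∸t])) ,
      (λ i → trans (is-image i) (sym (T-image preimage i)))
      where open InModel m

  ŵ : ℕ → ℕ → Coords
  ŵ s t = restrict (line s t)

  B-on-line : ∀ {r s t y} → r +ℕ s +ℕ t ≡ d → B r s t y → ∃ λ α → σ y ≋ α · ŵ s t
  B-on-line {r} {s} {t} {y} e y∈B = model-on-line s+t≤d (BT⇒InModel (σ-in-B e y y∈B))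
    where open Location {r} {s} {t} e

  line-in-B : ∀ {r s t y α} → r +ℕ s +ℕ t ≡ d → σ y ≋ α · ŵ s t → B r s t y
  line-in-B {r} {s} {t} {y} {α} e σy≋ = σ-from-B e y (InModel⇒BT (record
    { vanish-above  = λ i lt → trans (σy≋ i) (vanish-above i lt)
    ; vanish-below  = λ i lt → trans (σy≋ i) (vanish-below i lt)
    ; preimage      = preimage
    ; preimage-from = preimage-from
    ; is-image      = λ i → trans (σy≋ i) (is-image i)
    }))
    where
    open Location {r} {s} {t} e
    open InModel (line-in-model s t s+t≤d α)

  σ-0 : σ 0ᴹ ≋ 0ᵛ
  σ-0 i = trans (σ-cong (≈ᴹ-sym (*ₗ-zeroˡ 0ᴹ)) i) (trans (σ-* 0# 0ᴹ i) (zeroˡ _))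

  nonzero-vector : ∀ {s t y α} → s < suc d → ¬ α ≈ 0# → σ y ≋ α · ŵ s t → ¬ y ≈ᴹ 0ᴹ
  nonzero-vector {s} {t} {y} {α} s≤d α≉0 σy≋ y≈0 = *-nonzero α≉0 (line-bottom s t) (begin
    α * line s t s                     ≈⟨ *-cong refl (sym (restrict-at s≤d (line s t))) ⟩
    α * ŵ s t (fromℕ< s≤d)             ≈⟨ sym (σy≋ (fromℕ< s≤d)) ⟩
    σ y (fromℕ< s≤d)                   ≈⟨ σ-cong y≈0 (fromℕ< s≤d) ⟩
    σ 0ᴹ (fromℕ< s≤d)                  ≈⟨ σ-0 (fromℕ< s≤d) ⟩
    0#                                 ∎)

  nonzero-coefficient : ∀ {s t y α} → σ y ≋ α · ŵ s t → ¬ y ≈ᴹ 0ᴹ → ¬ α ≈ 0#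
  nonzero-coefficient σy≋ y≉0 α≈0 =
    y≉0 (σ-inj (λ i → trans (σy≋ i) (trans (*-cong α≈0 refl) (trans (zeroˡ _) (sym (σ-0 i))))))

  -- A clique step in coordinates becomes the map B̃_{P,Q} of the Billiard Array:
  -- it is defined on every nonzero vector of B_P and multiplies coefficients by ρ.
  module Step (sP tP rQ sQ tQ rR sR tR : ℕ) {ρ : Carrier}
    (eQ : rQ +ℕ sQ +ℕ tQ ≡ d) (eR : rR +ℕ sR +ℕ tR ≡ d)
    (step : CliqueStep (ŵ sP tP) (ŵ sQ tQ) (ŵ sR tR) ρ) where
    open CliqueStep step

    σ-sum : ∀ {u v α β} → σ u ≋ α · ŵ sP tP → σ v ≋ β · ŵ sQ tQ → σ (u +ᴹ v) ≋ α · ŵ sP tP ⊕ β · ŵ sQ tQ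
    σ-sum σu≋ σv≋ i = trans (σ-+ _ _ i) (+-cong (σu≋ i) (σv≋ i))

    forward : ∀ {u v α} → σ u ≋ α · ŵ sP tP → Tilde F V B (rQ , sQ , tQ) (rR , sR , tR) u v →
              σ v ≋ (ρ * α) · ŵ sQ tQ
    forward {α = α} σu≋ (v∈B , _ , u+v∈B) with B-on-line eQ v∈B | B-on-line eR u+v∈B
    ... | β , σv≋ | γ , σ[u+v]≋ = λ i → trans (σv≋ i) (*-cong β≈ρα refl)
      where
      β≈ρα : β ≈ ρ * α
      β≈ρα = forced (≋-trans (≋-sym (σ-sum σu≋ σv≋)) σ[u+v]≋)

    backward : ∀ {u α} → σ u ≋ α · ŵ sP tP → ¬ α ≈ 0# →
               ∃ λ v → Tilde F V B (rQ , sQ , tQ) (rR , sR , tR) u v × σ v ≋ (ρ * α) · ŵ sQ tQ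
    backward {u} {α} σu≋ α≉0 = v , (v∈B , v≉0 , u+v∈B) , σv≋
      where
      v : Carrierᴹ
      v = proj₁ (σ-surj ((ρ * α) · ŵ sQ tQ))
      σv≋ : σ v ≋ (ρ * α) · ŵ sQ tQ
      σv≋ = proj₂ (σ-surj ((ρ * α) · ŵ sQ tQ))
      v∈B : B rQ sQ tQ v
      v∈B = line-in-B eQ σv≋
      v≉0 : ¬ v ≈ᴹ 0ᴹ
      v≉0 = nonzero-vector (s≤s (ℕₚ.≤-trans (ℕₚ.m≤m+n sQ tQ) (Location.s+t≤d {rQ} eQ))) (*-nonzero ρ-nonzero α≉0) σv≋
      u+v∈B : B rR sR tR (u +ᴹ v)
      u+v∈B = line-in-B eR (≋-trans (σ-sum σu≋ σv≋) (proj₂ (admitted α)))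

  -- The product of the three ratios around a black 3-clique: ι^{t+1}, -q^t, -1.
  monodromy : ∀ t α → (- 1#) * ((- q^ t) * (ι^ (suc t) * α)) ≈ ι * α
  monodromy t α = begin
    (- 1#) * ((- q^ t) * (ι^ (suc t) * α))   ≈⟨ -1*x≈-x _ ⟩
    - ((- q^ t) * (ι^ (suc t) * α))          ≈⟨ -‿cong (sym (-‿distribˡ-* _ _)) ⟩
    - - (q^ t * (ι^ (suc t) * α))            ≈⟨ -‿involutive _ ⟩
    q^ t * ((ι * ι^ t) * α)                  ≈⟨ solve 4 (λ Q ι I α → Q :* ((ι :* I) :* α) := (Q :* I) :* (ι :* α)) refl (q^ t) ι (ι^ t) α ⟩
    (q^ t * ι^ t) * (ι * α)                  ≈⟨ *-cong (pow-inverse qι≈1 t) refl ⟩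
    1# * (ι * α)                             ≈⟨ *-identityˡ _ ⟩
    ι * α                                    ∎

  -- The black 3-cliques around τ = (r,s,t) ∈ Δ_{d-2}: the maps B̃_{λ,μ},
  -- B̃_{μ,ν}, B̃_{ν,λ} are the clique steps of the triangles at (s, t+1), (s, t)
  -- and (s+1, t).
  module AroundTau (r s t : ℕ) (r+s+t+2≡d : r +ℕ s +ℕ t +ℕ 2 ≡ d) where
    eλ : r +ℕ suc s +ℕ suc t ≡ d
    eλ = ≡.trans (λ-sum r s t) r+s+t+2≡d
    eμ : suc r +ℕ s +ℕ suc t ≡ d
    eμ = ≡.trans (μ-sum r s t) r+s+t+2≡d
    eν : suc r +ℕ suc s +ℕ t ≡ d
    eν = ≡.trans (ν-sum r s t) r+s+t+2≡d
    eλμ : r +ℕ s +ℕ suc (suc t) ≡ d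
    eλμ = ≡.trans (λμ-sum r s t) r+s+t+2≡d
    eμν : suc (suc r) +ℕ s +ℕ t ≡ d
    eμν = ≡.trans (μν-sum r s t) r+s+t+2≡d
    eνλ : r +ℕ suc (suc s) +ℕ t ≡ d
    eνλ = ≡.trans (νλ-sum r s t) r+s+t+2≡d

    step₁ : CliqueStep (ŵ (suc s) (suc t)) (ŵ s (suc t)) (ŵ s (suc (suc t))) (ι^ (suc t))
    step₁ = CliqueTriangle.stepBA s (suc t) (Location.s+t≤d {r} eλμ)
    step₂ : CliqueStep (ŵ s (suc t)) (ŵ (suc s) t) (ŵ s t) (- q^ t)
    step₂ = CliqueTriangle.stepCB s t (Location.s+t≤d {suc r} eμ)
    step₃ : CliqueStep (ŵ (suc s) t) (ŵ (suc s) (suc t)) (ŵ (suc (suc s)) t) (- 1#)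
    step₃ = CliqueTriangle.stepAC (suc s) t (Location.s+t≤d {r} eλ)

    module S₁ = Step (suc s) (suc t) (suc r) s (suc t) r s (suc (suc t)) eμ eλμ step₁
    module S₂ = Step s (suc t) (suc r) (suc s) t (suc (suc r)) s t eν eμν step₂
    module S₃ = Step (suc s) t r (suc s) (suc t) r (suc (suc s)) t eλ eνλ step₃

    B̃λμ B̃μν B̃νλ : Carrierᴹ → Carrierᴹ → Set (ℓm ⊔ p)
    B̃λμ = Tilde F V B (suc r , s , suc t) (r , s , suc (suc t))
    B̃μν = Tilde F V B (suc r , suc s , t) (suc (suc r) , s , t)
    B̃νλ = Tilde F V B (r , suc s , suc t) (r , suc (suc s) , t)

    around : ∀ {u α} → σ u ≋ α · ŵ (suc s) (suc t) → ¬ α ≈ 0# →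
             ∃ λ v → ∃ λ w → ∃ λ x → B̃λμ u v × B̃μν v w × B̃νλ w x
    around σu≋ α≉0 =
      let v , v-step , σv≋ = S₁.backward σu≋ α≉0
          w , w-step , σw≋ = S₂.backward σv≋ (*-nonzero ρ₁≉0 α≉0)
          x , x-step , _   = S₃.backward σw≋ (*-nonzero ρ₂≉0 (*-nonzero ρ₁≉0 α≉0))
      in v , w , x , v-step , w-step , x-step
      where
      ρ₁≉0 : ¬ ι^ (suc t) ≈ 0#
      ρ₁≉0 = CliqueStep.ρ-nonzero step₁
      ρ₂≉0 : ¬ - q^ t ≈ 0#
      ρ₂≉0 = CliqueStep.ρ-nonzero step₂

    around-is-ι : ∀ {u α} → σ u ≋ α · ŵ (suc s) (suc t) →
                  ∀ v w x → B̃λμ u v → B̃μν v w → B̃νλ w x → x ≈ᴹ ι *ₗ u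
    around-is-ι {u} {α} σu≋ v w x v-step w-step x-step = σ-inj λ i → begin
      σ x i                                          ≈⟨ S₃.forward (S₂.forward (S₁.forward σu≋ v-step) w-step) x-step i ⟩
      ((- 1#) * ((- q^ t) * (ι^ (suc t) * α))) * ŵ (suc s) (suc t) i ≈⟨ *-cong (monodromy t α) refl ⟩
      (ι * α) * ŵ (suc s) (suc t) i                  ≈⟨ *-assoc ι α _ ⟩
      ι * (α * ŵ (suc s) (suc t) i)                  ≈⟨ *-cong refl (sym (σu≋ i)) ⟩
      ι * σ u i                                      ≈⟨ sym (σ-* ι u i) ⟩
      σ (ι *ₗ u) i                                   ∎

  b-value : ∀ r s t → r +ℕ s +ℕ t +ℕ 2 ≡ d → IsBValue F V B r s t ι
  b-value r s t r+s+t+2≡d u u∈B u≉0 =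
    let α , σu≋ = B-on-line eλ u∈B
    in around σu≋ (nonzero-coefficient {suc s} {suc t} σu≋ u≉0) , around-is-ι σu≋
    where open AroundTau r s t r+s+t+2≡d

open import Data.Nat using (_+_)

-- Proposition 9.10.
proposition9p10 : ∀ {c ℓ m ℓm p : Level} (F : Field c ℓ) (d : ℕ) → 2 ≤ d →
    (q : Field.Carrier F) → ¬ (Field._≈_ F q (Field.0# F)) →
    (V : Module (Field.commutativeRing F) m ℓm) →
    (B : ℕ → ℕ → ℕ → Module.Carrierᴹ V → Set p) →
    IsoToBT F V d (Tq F d q) B →
    ∀ r s t → r + s + t + 2 ≡ d →
    ∀ (qinv : Field.Carrier F) → Field._≈_ F (Field._*_ F q qinv) (Field.1# F) →
    IsBValue F V B r s t qinv
proposition9p10 F d _ q _ V B iso r s t r+s+t+2≡d qinv qqinv≈1 =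
  BilliardArray.b-value F d q qinv qqinv≈1 V B iso r s t r+s+t+2≡d
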